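{- Let $h\geq 1$, let $u=(2^{h+1}-2)\bmod h$, and define $\vec c^*=[c^*_1,\ldots,c^*_h]$ by $c^*_i=\left\lfloor \frac{2^{h+1}-2}{h}\right\rfloor$ for $1\leq i\leq h-u$ and $c^*_i=\left\lceil \frac{2^{h+1}-2}{h}\right\rceil$ for $h-u+1\leq i\leq h$. Then $\vec c^*$ is $h$-feasible, i.e. (C1) $\sum_{i=1}^{\ell} c^*_i\geq \sum_{i=1}^{\ell}2^i$ for every $1\leq \ell\leq h$, and (C2) $\sum_{i=1}^{h} c^*_i = 2^{h+1}-2$. -}

module Defs where

open import Data.Nat using (ℕ; zero; suc; _+_; _∸_; _^_; _≤_; _<_; _≤ᵇ_; NonZero)
open import Data.Nat.DivMod using (_/_; _%_)
open import Data.Bool using (if_then_else_)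
open import Data.Product using (_×_)
open import Relation.Binary.PropositionalEquality using (_≡_)

sum1 : (ℕ → ℕ) → ℕ → ℕ
sum1 f zero    = 0
sum1 f (suc ℓ) = sum1 f ℓ + f (suc ℓ)

⌈_/_⌉ : (a h : ℕ) → .{{NonZero h}} → ℕ
⌈ a / h ⌉ = (a + (h ∸ 1)) / h

N : ℕ → ℕ
N h = 2 ^ (suc h) ∸ 2

u : (h : ℕ) → .{{NonZero h}} → ℕ
u h = N h % h

-- c*_i for 1 ≤ i ≤ h  (values for i outside 1..h are irrelevant)
cstar : (h : ℕ) → .{{NonZero h}} → ℕ → ℕ
cstar h i = if i ≤ᵇ (h ∸ u h) then N h / h else ⌈ N h / h ⌉

Feasible : ℕ → (ℕ → ℕ) → Set
Feasible h c =
  ((ℓ : ℕ) → 1 ≤ ℓ → ℓ ≤ h → sum1 (λ i → 2 ^ i) ℓ ≤ sum1 c ℓ)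
  × (sum1 c h ≡ 2 ^ (suc h) ∸ 2)

{-# OPTIONS --safe #-}
-- The sequence c* is balanced: all its terms lie between q = ⌊N/h⌋ and q + 1,
-- and its total is N = Σ_{i ≤ h} 2^i. Fix ℓ ≤ h. If 2^ℓ ≤ q, then every 2^i
-- with i ≤ ℓ is at most c*_i, so the prefix sums compare termwise. Otherwise
-- q + 1 ≤ 2^ℓ ≤ 2^i for all i > ℓ, so the suffix of c* is at most the suffix of
-- the powers of 2; as the totals agree, the prefix of c* is at least theirs.
module Submission where

open import Defs
open import Data.Nat using (ℕ; NonZero; zero; suc; _+_; _*_; _∸_; _^_; _≤_; _<_; _≤ᵇ_; z≤n; s≤s; _≤?_)
open import Data.Nat.Properties
open import Data.Nat.DivMod using (_/_; _%_; m≡m%n+[m/n]*n; m<n⇒m/n≡0; m%n≤n; m*n/n≡m; n/n≡1; +-distrib-/-∣ʳ)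
open import Algebra.Properties.CommutativeSemigroup +-commutativeSemigroup using () renaming (xy∙z≈xz∙y to +-right-comm)
open import Data.Nat.Divisibility using (n∣m*n; n∣n)
open import Data.Bool using (true; false; if_then_else_)
open import Data.Unit using (tt)
open import Data.Empty using (⊥-elim)
open import Data.Product using (_,_)
open import Relation.Nullary using (yes; no)
open import Relation.Binary.PropositionalEquality
open import Data.Nat.Tactic.RingSolver using (solve-∀)

sum1-cong : ∀ {f g : ℕ → ℕ} ℓ → (∀ {i} → i ≤ ℓ → f i ≡ g i) → sum1 f ℓ ≡ sum1 g ℓ
sum1-cong zero    f≡g = refl
sum1-cong (suc ℓ) f≡g = cong₂ _+_ (sum1-cong ℓ (λ i≤ℓ → f≡g (m≤n⇒m≤1+n i≤ℓ))) (f≡g ≤-refl)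

sum1-mono : ∀ {f g : ℕ → ℕ} ℓ → (∀ {i} → i ≤ ℓ → f i ≤ g i) → sum1 f ℓ ≤ sum1 g ℓ
sum1-mono zero    f≤g = z≤n
sum1-mono (suc ℓ) f≤g = +-mono-≤ (sum1-mono ℓ (λ i≤ℓ → f≤g (m≤n⇒m≤1+n i≤ℓ))) (f≤g ≤-refl)

sum1-const : ∀ x ℓ → sum1 (λ _ → x) ℓ ≡ ℓ * x
sum1-const x zero    = refl
sum1-const x (suc ℓ) = trans (cong (_+ x) (sum1-const x ℓ)) (+-comm (ℓ * x) x)

sum1-+ : ∀ f m n → sum1 f (m + n) ≡ sum1 f m + sum1 (λ j → f (m + j)) n
sum1-+ f m zero    = trans (cong (sum1 f) (+-identityʳ m)) (sym (+-identityʳ _))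
sum1-+ f m (suc n) = begin
  sum1 f (m + suc n)                                  ≡⟨ cong (sum1 f) (+-suc m n) ⟩
  sum1 f (m + n) + f (suc (m + n))                    ≡⟨ cong₂ _+_ (sum1-+ f m n) (cong f (sym (+-suc m n))) ⟩
  sum1 f m + sum1 (λ j → f (m + j)) n + f (m + suc n) ≡⟨ +-assoc (sum1 f m) _ _ ⟩
  sum1 f m + sum1 (λ j → f (m + j)) (suc n)           ∎
  where open ≡-Reasoning

sum1-step : ∀ t r (x y : ℕ) → sum1 (λ i → if i ≤ᵇ t then x else y) (t + r) ≡ t * x + r * y
sum1-step t zero x y = begin
  sum1 (λ i → if i ≤ᵇ t then x else y) (t + 0) ≡⟨ cong (sum1 _) (+-identityʳ t) ⟩
  sum1 (λ i → if i ≤ᵇ t then x else y) t       ≡⟨ sum1-cong t below ⟩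
  sum1 (λ _ → x) t                             ≡⟨ sum1-const x t ⟩
  t * x                                        ≡⟨ +-identityʳ (t * x) ⟨
  t * x + 0 * y                                ∎
  where
  open ≡-Reasoning
  below : ∀ {i} → i ≤ t → (if i ≤ᵇ t then x else y) ≡ x
  below {i} i≤t with i ≤ᵇ t | ≤⇒≤ᵇ i≤t
  ... | true | _ = refl
sum1-step t (suc r) x y = begin
  sum1 c (t + suc r)                                   ≡⟨ cong (sum1 c) (+-suc t r) ⟩
  sum1 c (t + r) + (if suc (t + r) ≤ᵇ t then x else y) ≡⟨ cong₂ _+_ (sum1-step t r x y) beyond ⟩
  t * x + r * y + y                                    ≡⟨ +-assoc (t * x) (r * y) y ⟩
  t * x + (r * y + y)                                  ≡⟨ cong (t * x +_) (+-comm (r * y) y) ⟩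
  t * x + suc r * y                                    ∎
  where
  open ≡-Reasoning
  c : ℕ → ℕ
  c i = if i ≤ᵇ t then x else y
  beyond : (if suc (t + r) ≤ᵇ t then x else y) ≡ y
  beyond with suc (t + r) ≤ᵇ t | ≤ᵇ⇒≤ (suc (t + r)) t
  ... | false | _  = refl
  ... | true  | le = ⊥-elim (<⇒≱ (s≤s (m≤m+n t r)) (le tt))

sum1-2^+2 : ∀ ℓ → sum1 (2 ^_) ℓ + 2 ≡ 2 ^ suc ℓ
sum1-2^+2 zero    = refl
sum1-2^+2 (suc ℓ) = begin
  sum1 (2 ^_) ℓ + 2 ^ suc ℓ + 2   ≡⟨ +-right-comm (sum1 (2 ^_) ℓ) (2 ^ suc ℓ) 2 ⟩
  sum1 (2 ^_) ℓ + 2 + 2 ^ suc ℓ   ≡⟨ cong (_+ 2 ^ suc ℓ) (sum1-2^+2 ℓ) ⟩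
  2 ^ suc ℓ + 2 ^ suc ℓ           ≡⟨ cong (2 ^ suc ℓ +_) (+-identityʳ (2 ^ suc ℓ)) ⟨
  2 ^ suc (suc ℓ)                 ∎
  where open ≡-Reasoning

sum1-2^ : ∀ ℓ → sum1 (2 ^_) ℓ ≡ 2 ^ suc ℓ ∸ 2
sum1-2^ ℓ = trans (sym (m+n∸n≡m _ 2)) (cong (_∸ 2) (sum1-2^+2 ℓ))

⌈0/n⌉≡0 : ∀ n .{{_ : NonZero n}} → ⌈ 0 / n ⌉ ≡ 0
⌈0/n⌉≡0 (suc n) = m<n⇒m/n≡0 ≤-refl

⌈1+m/n⌉≡1 : ∀ m n .{{_ : NonZero n}} → m < n → ⌈ suc m / n ⌉ ≡ 1
⌈1+m/n⌉≡1 m n@(suc n-1) m<n = begin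
  (suc m + n-1) / n      ≡⟨ cong (_/ n) (+-suc m n-1) ⟨
  (m + n) / n            ≡⟨ +-distrib-/-∣ʳ m n∣n ⟩
  m / n + n / n          ≡⟨ cong₂ _+_ (m<n⇒m/n≡0 m<n) (n/n≡1 n) ⟩
  1                      ∎
  where open ≡-Reasoning

⌈m/n⌉≤1 : ∀ m n .{{_ : NonZero n}} → m ≤ n → ⌈ m / n ⌉ ≤ 1
⌈m/n⌉≤1 zero    n _   = ≤-trans (≤-reflexive (⌈0/n⌉≡0 n)) z≤n
⌈m/n⌉≤1 (suc m) n m<n = ≤-reflexive (⌈1+m/n⌉≡1 m n m<n)

m*⌈m/n⌉≡m : ∀ m n .{{_ : NonZero n}} → m ≤ n → m * ⌈ m / n ⌉ ≡ m
m*⌈m/n⌉≡m zero    n _   = refl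
m*⌈m/n⌉≡m (suc m) n m<n = trans (cong (suc m *_) (⌈1+m/n⌉≡1 m n m<n)) (*-identityʳ (suc m))

⌈m/n⌉≡⌈m%n/n⌉+m/n : ∀ m n .{{_ : NonZero n}} → ⌈ m / n ⌉ ≡ ⌈ m % n / n ⌉ + m / n
⌈m/n⌉≡⌈m%n/n⌉+m/n m n = begin
  (m + (n ∸ 1)) / n                  ≡⟨ cong (λ k → (k + (n ∸ 1)) / n) (m≡m%n+[m/n]*n m n) ⟩
  (m % n + m / n * n + (n ∸ 1)) / n  ≡⟨ cong (_/ n) (+-right-comm (m % n) (m / n * n) (n ∸ 1)) ⟩
  (m % n + (n ∸ 1) + m / n * n) / n  ≡⟨ +-distrib-/-∣ʳ (m % n + (n ∸ 1)) (n∣m*n (m / n)) ⟩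
  ⌈ m % n / n ⌉ + m / n * n / n      ≡⟨ cong (⌈ m % n / n ⌉ +_) (m*n/n≡m (m / n) n) ⟩
  ⌈ m % n / n ⌉ + m / n              ∎
  where open ≡-Reasoning

m/n≤⌈m/n⌉ : ∀ m n .{{_ : NonZero n}} → m / n ≤ ⌈ m / n ⌉
m/n≤⌈m/n⌉ m n = subst (m / n ≤_) (sym (⌈m/n⌉≡⌈m%n/n⌉+m/n m n)) (m≤n+m (m / n) _)

⌈m/n⌉≤1+m/n : ∀ m n .{{_ : NonZero n}} → ⌈ m / n ⌉ ≤ suc (m / n)
⌈m/n⌉≤1+m/n m n = subst (_≤ suc (m / n)) (sym (⌈m/n⌉≡⌈m%n/n⌉+m/n m n))
  (+-monoˡ-≤ (m / n) (⌈m/n⌉≤1 (m % n) n (m%n≤n m n)))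

[n∸m%n]*[m/n]+m%n*⌈m/n⌉≡m : ∀ m n .{{_ : NonZero n}} → (n ∸ m % n) * (m / n) + m % n * ⌈ m / n ⌉ ≡ m
[n∸m%n]*[m/n]+m%n*⌈m/n⌉≡m m n = begin
  (n ∸ r) * q + r * ⌈ m / n ⌉           ≡⟨ cong (λ k → (n ∸ r) * q + r * k) (⌈m/n⌉≡⌈m%n/n⌉+m/n m n) ⟩
  (n ∸ r) * q + r * (⌈ r / n ⌉ + q)     ≡⟨ cong ((n ∸ r) * q +_) (*-distribˡ-+ r ⌈ r / n ⌉ q) ⟩
  (n ∸ r) * q + (r * ⌈ r / n ⌉ + r * q) ≡⟨ cong (λ k → (n ∸ r) * q + (k + r * q)) (m*⌈m/n⌉≡m r n (m%n≤n m n)) ⟩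
  (n ∸ r) * q + (r + r * q)             ≡⟨ regroup (n ∸ r) r q ⟩
  r + q * (n ∸ r + r)                   ≡⟨ cong (λ k → r + q * k) (m∸n+n≡m (m%n≤n m n)) ⟩
  r + q * n                             ≡⟨ m≡m%n+[m/n]*n m n ⟨
  m                                     ∎
  where
  open ≡-Reasoning
  r = m % n
  q = m / n
  regroup : ∀ a r q → a * q + (r + r * q) ≡ r + q * (a + r)
  regroup = solve-∀

prefix-dominance : ∀ (p c : ℕ → ℕ) q h →
                   (∀ {i j} → i ≤ j → p i ≤ p j) → (∀ i → q ≤ c i) → (∀ i → c i ≤ suc q) →
                   sum1 p h ≡ sum1 c h → ∀ {ℓ} → ℓ ≤ h → sum1 p ℓ ≤ sum1 c ℓ
prefix-dominance p c q h p-mono q≤c c≤1+q Σp≡Σc {ℓ} ℓ≤h with p ℓ ≤? q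
... | yes pℓ≤q = sum1-mono ℓ (λ i≤ℓ → ≤-trans (p-mono i≤ℓ) (≤-trans pℓ≤q (q≤c _)))
... | no  pℓ≰q = +-cancelʳ-≤ (suffix p) (sum1 p ℓ) (sum1 c ℓ) (begin
  sum1 p ℓ + suffix p ≡⟨ sum1-+ p ℓ k ⟨
  sum1 p (ℓ + k)      ≡⟨ cong (sum1 p) ℓ+k≡h ⟩
  sum1 p h            ≡⟨ Σp≡Σc ⟩
  sum1 c h            ≡⟨ cong (sum1 c) ℓ+k≡h ⟨
  sum1 c (ℓ + k)      ≡⟨ sum1-+ c ℓ k ⟩
  sum1 c ℓ + suffix c ≤⟨ +-monoʳ-≤ (sum1 c ℓ) (sum1-mono k (λ {j} _ → c≤p j)) ⟩
  sum1 c ℓ + suffix p ∎)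
  where
  open ≤-Reasoning
  k = h ∸ ℓ
  ℓ+k≡h : ℓ + k ≡ h
  ℓ+k≡h = m+[n∸m]≡n ℓ≤h
  suffix : (ℕ → ℕ) → ℕ
  suffix f = sum1 (λ j → f (ℓ + j)) k
  c≤p : ∀ j → c (ℓ + j) ≤ p (ℓ + j)
  c≤p j = ≤-trans (c≤1+q (ℓ + j)) (≤-trans (≰⇒> pℓ≰q) (p-mono (m≤m+n ℓ j)))

N/h≤cstar : ∀ h .{{_ : NonZero h}} i → N h / h ≤ cstar h i
N/h≤cstar h i with i ≤ᵇ (h ∸ u h)
... | true  = ≤-refl
... | false = m/n≤⌈m/n⌉ (N h) h

cstar≤1+N/h : ∀ h .{{_ : NonZero h}} i → cstar h i ≤ suc (N h / h)
cstar≤1+N/h h i with i ≤ᵇ (h ∸ u h)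
... | true  = n≤1+n (N h / h)
... | false = ⌈m/n⌉≤1+m/n (N h) h

corollary2 : (h : ℕ) → .{{_ : NonZero h}} → Feasible h (cstar h)
corollary2 h = C1 , C2
  where
  open ≡-Reasoning
  C2 : sum1 (cstar h) h ≡ 2 ^ suc h ∸ 2
  C2 = begin
    sum1 (cstar h) h                          ≡⟨ cong (sum1 (cstar h)) (m∸n+n≡m (m%n≤n (N h) h)) ⟨
    sum1 (cstar h) (h ∸ u h + u h)            ≡⟨ sum1-step (h ∸ u h) (u h) (N h / h) ⌈ N h / h ⌉ ⟩
    (h ∸ u h) * (N h / h) + u h * ⌈ N h / h ⌉ ≡⟨ [n∸m%n]*[m/n]+m%n*⌈m/n⌉≡m (N h) h ⟩
    N h                                       ∎
  C1 : (ℓ : ℕ) → 1 ≤ ℓ → ℓ ≤ h → sum1 (2 ^_) ℓ ≤ sum1 (cstar h) ℓ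
  C1 ℓ _ = prefix-dominance (2 ^_) (cstar h) (N h / h) h (^-monoʳ-≤ 2) (N/h≤cstar h) (cstar≤1+N/h h)
             (trans (sum1-2^ h) (sym C2))
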